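{- For the path $P_n$ on $n\ge 2$ vertices, \[\operatorname{fp}(P_n)=\left\lceil\frac{n-1}{3}\right\rceil\quad\text{and}\quad \nu_{\operatorname{ind}}(P_n)=\left\lceil\frac{n-1}{3}\right\rceil.\] In particular $\operatorname{fp}(P_n)=\nu_{\operatorname{ind}}(P_n)$ for all $n\ge 2$.
   Context: A bipartite graph is a Ferrers graph if it contains no induced copy of $2K_2$ (two disjoint edges with no other edges among their four endpoints). For a bipartite graph $G=(U,V,E)$, $\operatorname{fp}(G)$ is the minimum $k$ such that $E$ can be partitioned into $k$ sets $E_i$ with each spanning subgraph $(U,V,E_i)$ a Ferrers graph. An induced matching is a matching $M$ such that for any two distinct edges $uv,u'v'\in M$ the only edges of the graph among $\{u,v,u',v'\}$ are $uv,u'v'$; $\nu_{\operatorname{ind}}(G)$ is the maximum size of an induced matching. $P_n$ is the path on $n$ vertices. -}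

module Defs where

open import Data.Nat using (ℕ; zero; suc; _+_; _*_; _∸_; _≤_; _<_; _≡ᵇ_; ⌊_/2⌋; ⌈_/2⌉)
open import Data.Nat.DivMod using (_/_)
open import Data.Bool using (Bool; true; false; _∨_)
open import Data.Fin using (Fin; toℕ)
open import Data.Product using (_×_; Σ; ∃; _,_)
open import Relation.Nullary using (¬_)
open import Relation.Binary.PropositionalEquality using (_≡_; _≢_)

record BipGraph : Set where
  field
    p   : ℕ
    q   : ℕ
    adj : Fin p → Fin q → Bool

open BipGraph public

Edge : (G : BipGraph) → Fin (p G) → Fin (q G) → Set
Edge G u v = adj G u v ≡ true

-- A bipartite graph on (Fin p, Fin q) whose edge set is a predicate F is
-- Ferrers iff it has no induced 2K₂: no u u' ∈ U, v v' ∈ V with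
-- uv, u'v' edges and uv', u'v non-edges (U–U and V–V edges cannot exist).
IsFerrers : {p q : ℕ} → (Fin p → Fin q → Set) → Set
IsFerrers {p} {q} F =
  ¬ (Σ (Fin p) λ u → Σ (Fin p) λ u' → Σ (Fin q) λ v → Σ (Fin q) λ v' →
       F u v × F u' v' × ¬ F u v' × ¬ F u' v)

-- A partition of E(G) into k classes E₀,…,E_{k-1}: every pair (u,v) gets a
-- label in Fin k (labels of non-edges are irrelevant); E_i = edges labelled i.
FerrersPartition : (G : BipGraph) → (k : ℕ) → Set
FerrersPartition G k =
  Σ (Fin (p G) → Fin (q G) → Fin k) λ col →
    (i : Fin k) → IsFerrers (λ u v → Edge G u v × col u v ≡ i)

FpEq : BipGraph → ℕ → Set
FpEq G k = FerrersPartition G k × ((k' : ℕ) → k' < k → ¬ FerrersPartition G k')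

-- An induced matching of size r: edges a(i) b(i) (i < r) such that for i ≠ j
-- the pair a(i) b(j) is not an edge. (This forces a, b injective, so the
-- edges are pairwise disjoint, and no other edge lies among the endpoints.)
InducedMatching : (G : BipGraph) → (r : ℕ) → Set
InducedMatching G r =
  Σ (Fin r → Fin (p G)) λ a → Σ (Fin r → Fin (q G)) λ b →
    ((i : Fin r) → Edge G (a i) (b i)) ×
    ((i j : Fin r) → i ≢ j → ¬ Edge G (a i) (b j))

NuIndEq : BipGraph → ℕ → Set
NuIndEq G r = InducedMatching G r × ((r' : ℕ) → InducedMatching G r' → r' ≤ r)

pathAdjℕ : ℕ → ℕ → Bool
pathAdjℕ a b = (suc a ≡ᵇ b) ∨ (suc b ≡ᵇ a)

-- The path P_n with its bipartition: U = even vertices 0,2,4,… (⌈n/2⌉ of them,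
-- u_i = 2i), V = odd vertices 1,3,… (⌊n/2⌋ of them, v_j = 2j+1).
Path : ℕ → BipGraph
Path n = record
  { p   = ⌈ n /2⌉
  ; q   = ⌊ n /2⌋
  ; adj = λ i j → pathAdjℕ (2 * toℕ i) (suc (2 * toℕ j))
  }

ceilNm1div3 : ℕ → ℕ
ceilNm1div3 n = ((n ∸ 1) + 2) / 3

{-# OPTIONS --safe #-}
-- Number the edges of P_n as 0, 1, …, n − 2 along the path, so that edge e
-- joins u_⌈e/2⌉ and v_⌊e/2⌋. If e ≤ f ≤ e + 2, one of the pairs
-- (u_⌈e/2⌉, v_⌊f/2⌋), (u_⌈f/2⌉, v_⌊e/2⌋) is itself an edge numbered between
-- e and f. Hence cutting the path into blocks of three consecutive edges gives
-- ⌈(n−1)/3⌉ Ferrers classes, while the edges 0, 3, 6, … form an induced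
-- matching of the same size. No induced matching is larger than a Ferrers
-- partition: by pigeonhole two of its edges would share a class and form an
-- induced 2K₂ there.
module Submission where

open import Defs
open import Data.Bool using (true)
open import Data.Bool.Properties using (T-≡; T-∨)
open import Data.Empty using (⊥-elim)
open import Data.Fin using (Fin; toℕ; fromℕ<)
open import Data.Fin.Properties
  using (toℕ≤pred[n]; toℕ-fromℕ<; toℕ-injective; fromℕ<-cong; fromℕ<-injective; pigeonhole)
open import Data.Nat
open import Data.Nat.DivMod using (_/_; m/n≡1+[m∸n]/n; m/n*n≤m; /-monoˡ-≤)
open import Data.Nat.Properties
open import Data.Product as Product using (_×_; _,_; ∃-syntax)
open import Data.Sum as Sum using (_⊎_; inj₁; inj₂; [_,_])
open import Function using (_∘_; Equivalence)
open import Relation.Binary using (tri<; tri≈; tri>)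
open import Relation.Binary.PropositionalEquality
  using (_≡_; _≢_; refl; sym; trans; cong; cong₂; subst₂)
open import Relation.Nullary using (¬_)

open Equivalence using (to; from)

inducedMatching≤ferrersPartition : ∀ {G r k} →
  InducedMatching G r → FerrersPartition G k → r ≤ k
inducedMatching≤ferrersPartition (a , b , matched , induced) (col , ferrers) =
  ≮⇒≥ λ k<r →
    let i , j , i<j , sameClass = pigeonhole k<r (λ t → col (a t) (b t))
        i≢j = λ i≡j → <-irrefl (cong toℕ i≡j) i<j
    in ferrers (col (a i) (b i))
         ( a i , a j , b i , b j , (matched i , refl) , (matched j , sym sameClass)
         , (λ (e , _) → induced i j i≢j e) , (λ (e , _) → induced j i (i≢j ∘ sym) e))

fpEq×nuIndEq : ∀ {G m} → InducedMatching G m → FerrersPartition G m → FpEq G m × NuIndEq G m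
fpEq×nuIndEq M P =
  (P , λ k k<m Q → <⇒≱ k<m (inducedMatching≤ferrersPartition M Q)) ,
  (M , λ r N → inducedMatching≤ferrersPartition N P)

isFerrers-byKey : ∀ {p q} {F : Fin p → Fin q → Set} (key : Fin p → Fin q → ℕ) →
  (∀ u v u' v' → F u v → F u' v' → key u v ≤ key u' v' → F u v' ⊎ F u' v) →
  IsFerrers F
isFerrers-byKey key cross (u , u' , v , v' , uv , u'v' , ¬uv' , ¬u'v)
  with ≤-total (key u v) (key u' v')
... | inj₁ uv≤u'v' = [ ¬uv' , ¬u'v ] (cross u v u' v' uv u'v' uv≤u'v')
... | inj₂ u'v'≤uv = [ ¬u'v , ¬uv' ] (cross u' v' u v u'v' uv u'v'≤uv)

pathAdjℕ⇒adjacent : ∀ x y → pathAdjℕ x y ≡ true → suc x ≡ y ⊎ suc y ≡ x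
pathAdjℕ⇒adjacent x y adj =
  Sum.map (≡ᵇ⇒≡ (suc x) y) (≡ᵇ⇒≡ (suc y) x) (to T-∨ (from T-≡ adj))

adjacent⇒pathAdjℕ : ∀ x y → suc x ≡ y ⊎ suc y ≡ x → pathAdjℕ x y ≡ true
adjacent⇒pathAdjℕ x y adj =
  to T-≡ (from T-∨ (Sum.map (≡⇒≡ᵇ (suc x) y) (≡⇒≡ᵇ (suc y) x) adj))

-- PathEdge a b: the vertices u_a = 2a and v_b = 2b + 1 of the path are adjacent.
data PathEdge : ℕ → ℕ → Set where
  even : ∀ k → PathEdge k k
  odd  : ∀ k → PathEdge (suc k) k

pathAdjℕ⇒PathEdge : ∀ a b → pathAdjℕ (2 * a) (suc (2 * b)) ≡ true → PathEdge a b
pathAdjℕ⇒PathEdge a b adj with pathAdjℕ⇒adjacent (2 * a) (suc (2 * b)) adj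
... | inj₁ 2a+1≡2b+1 =
  subst₂ PathEdge refl (*-cancelˡ-≡ a b 2 (suc-injective 2a+1≡2b+1)) (even a)
... | inj₂ 2b+2≡2a =
  subst₂ PathEdge (*-cancelˡ-≡ (suc b) a 2 (trans (*-suc 2 b) 2b+2≡2a)) refl (odd b)

PathEdge⇒pathAdjℕ : ∀ {a b} → PathEdge a b → pathAdjℕ (2 * a) (suc (2 * b)) ≡ true
PathEdge⇒pathAdjℕ (even k) = adjacent⇒pathAdjℕ (2 * k) (suc (2 * k)) (inj₁ refl)
PathEdge⇒pathAdjℕ (odd k)  =
  adjacent⇒pathAdjℕ (2 * suc k) (suc (2 * k)) (inj₂ (sym (*-suc 2 k)))

PathEdge-suc : ∀ {a b} → PathEdge a b → PathEdge (suc a) (suc b)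
PathEdge-suc (even k) = even (suc k)
PathEdge-suc (odd k)  = odd (suc k)

ends : ℕ → ℕ × ℕ
ends e = ⌈ e /2⌉ , ⌊ e /2⌋

PathEdge-ends : ∀ e → PathEdge ⌈ e /2⌉ ⌊ e /2⌋
PathEdge-ends 0             = even 0
PathEdge-ends 1             = odd 0
PathEdge-ends (suc (suc e)) = PathEdge-suc (PathEdge-ends e)

PathEdge⇒ends : ∀ {a b} → PathEdge a b → ends (a + b) ≡ (a , b)
PathEdge⇒ends (even k) = cong₂ _,_ (sym (n≡⌈n+n/2⌉ k)) (sym (n≡⌊n+n/2⌋ k))
PathEdge⇒ends (odd k)  =
  cong₂ _,_ (cong suc (sym (n≡⌊n+n/2⌋ k))) (sym (n≡⌈n+n/2⌉ k))

ends⇒PathEdge : ∀ {g a b} → ends g ≡ (a , b) → PathEdge a b × a + b ≡ g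
ends⇒PathEdge {g} refl = PathEdge-ends g , trans (+-comm ⌈ g /2⌉ ⌊ g /2⌋) (⌊n/2⌋+⌈n/2⌉≡n g)

crossingEdge : ∀ {e f} → e ≤ f → f ≤ 2 + e →
  ∃[ g ] e ≤ g × g ≤ f ×
    (ends g ≡ (⌈ e /2⌉ , ⌊ f /2⌋) ⊎ ends g ≡ (⌈ f /2⌉ , ⌊ e /2⌋))
crossingEdge {0} {0} _ _ = 0 , z≤n , z≤n , inj₁ refl
crossingEdge {0} {1} _ _ = 0 , z≤n , z≤n , inj₁ refl
crossingEdge {0} {2} _ _ = 1 , z≤n , s≤s z≤n , inj₂ refl
crossingEdge {0} {suc (suc (suc _))} _ (s≤s (s≤s ()))
crossingEdge {1} {1} _ _ = 1 , ≤-refl , ≤-refl , inj₁ refl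
crossingEdge {1} {2} _ _ = 2 , s≤s z≤n , ≤-refl , inj₁ refl
crossingEdge {1} {3} _ _ = 2 , s≤s z≤n , s≤s (s≤s z≤n) , inj₁ refl
crossingEdge {1} {suc (suc (suc (suc _)))} _ (s≤s (s≤s (s≤s ())))
crossingEdge {suc (suc e)} {suc (suc f)} (s≤s (s≤s e≤f)) (s≤s (s≤s f≤2+e))
  with g , e≤g , g≤f , cross ← crossingEdge e≤f f≤2+e
  = suc (suc g) , s≤s (s≤s e≤g) , s≤s (s≤s g≤f)
  , Sum.map (cong (Product.map suc suc)) (cong (Product.map suc suc)) cross

[3+n]/3≡1+n/3 : ∀ n → (3 + n) / 3 ≡ suc (n / 3)
[3+n]/3≡1+n/3 n = m/n≡1+[m∸n]/n (m≤m+n 3 n)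

sameBlock⇒≤2+ : ∀ {e f} → e / 3 ≡ f / 3 → f ≤ 2 + e
sameBlock⇒≤2+ {e} {f} sameBlock = ≮⇒≥ λ 2+e<f → <-irrefl sameBlock (begin-strict
  e / 3         <⟨ n<1+n (e / 3) ⟩
  suc (e / 3)   ≡⟨ [3+n]/3≡1+n/3 e ⟨
  (3 + e) / 3   ≤⟨ /-monoˡ-≤ 3 2+e<f ⟩
  f / 3         ∎)
  where open ≤-Reasoning

/-squeeze : ∀ {l m n} d .{{_ : NonZero d}} →
  l ≤ m → m ≤ n → l / d ≡ n / d → m / d ≡ l / d
/-squeeze d l≤m m≤n l/d≡n/d =
  ≤-antisym (≤-trans (/-monoˡ-≤ d m≤n) (≤-reflexive (sym l/d≡n/d))) (/-monoˡ-≤ d l≤m)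

sameBlock⇒crossingEdge : ∀ {a b a' b'} → PathEdge a b → PathEdge a' b' →
  a + b ≤ a' + b' → (a + b) / 3 ≡ (a' + b') / 3 →
  (PathEdge a b' × (a + b') / 3 ≡ (a + b) / 3) ⊎
  (PathEdge a' b × (a' + b) / 3 ≡ (a + b) / 3)
sameBlock⇒crossingEdge {a} {b} ab a'b' e≤f sameBlock
  with g , e≤g , g≤f , cross ← crossingEdge e≤f (sameBlock⇒≤2+ sameBlock)
  = Sum.map (inBlock ∘ relabel (PathEdge⇒ends ab) (PathEdge⇒ends a'b'))
            (inBlock ∘ relabel (PathEdge⇒ends a'b') (PathEdge⇒ends ab)) cross
  where
  relabel : ∀ {x y x' y' e f} → ends e ≡ (x , y) → ends f ≡ (x' , y') →
    ends g ≡ (⌈ e /2⌉ , ⌊ f /2⌋) → ends g ≡ (x , y')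
  relabel refl refl endsg = endsg
  inBlock : ∀ {x y} → ends g ≡ (x , y) → PathEdge x y × (x + y) / 3 ≡ (a + b) / 3
  inBlock endsg with xy , x+y≡g ← ends⇒PathEdge endsg
    rewrite x+y≡g = xy , /-squeeze 3 e≤g g≤f sameBlock

PathEdge⇒≤ : ∀ {a b} → PathEdge a b → b ≤ a × a ≤ suc b
PathEdge⇒≤ (even k) = ≤-refl , n≤1+n k
PathEdge⇒≤ (odd k)  = n≤1+n k , ≤-refl

far⇒¬PathEdge : ∀ {x y} → 3 + x ≤ y ⊎ 3 + y ≤ x → ¬ PathEdge ⌈ x /2⌉ ⌊ y /2⌋
far⇒¬PathEdge (inj₁ 3+x≤y) edge =
  <⇒≱ (⌊n/2⌋-mono 3+x≤y) (Product.proj₁ (PathEdge⇒≤ edge))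
far⇒¬PathEdge (inj₂ 3+y≤x) edge =
  <⇒≱ (⌈n/2⌉-mono 3+y≤x) (Product.proj₂ (PathEdge⇒≤ edge))

module _ (n : ℕ) where

  private
    U = Fin ⌈ 2 + n /2⌉
    V = Fin ⌊ 2 + n /2⌋

  index : U → V → ℕ
  index u v = toℕ u + toℕ v

  index≤n : ∀ u v → index u v ≤ n
  index≤n u v = begin
    toℕ u + toℕ v         ≤⟨ +-mono-≤ (toℕ≤pred[n] u) (toℕ≤pred[n] v) ⟩
    ⌈ n /2⌉ + ⌊ n /2⌋     ≡⟨ +-comm ⌈ n /2⌉ ⌊ n /2⌋ ⟩
    ⌊ n /2⌋ + ⌈ n /2⌉     ≡⟨ ⌊n/2⌋+⌈n/2⌉≡n n ⟩
    n                     ∎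
    where open ≤-Reasoning

  block : U → V → Fin (suc (n / 3))
  block u v = fromℕ< (s≤s (/-monoˡ-≤ 3 (index≤n u v)))

  block-injective : ∀ {u v u' v'} →
    block u v ≡ block u' v' → index u v / 3 ≡ index u' v' / 3
  block-injective {u} {v} {u'} {v'} = fromℕ<-injective (index u v / 3) (index u' v' / 3) _ _

  block-cong : ∀ {u v u' v'} →
    index u v / 3 ≡ index u' v' / 3 → block u v ≡ block u' v'
  block-cong {u} {v} {u'} {v'} eq = fromℕ<-cong (index u v / 3) (index u' v' / 3) eq _ _

  pathFerrersPartition : FerrersPartition (Path (2 + n)) (suc (n / 3))
  pathFerrersPartition = block , λ c → isFerrers-byKey index (cross c)
    where
    InClass : Fin (suc (n / 3)) → U → V → Set
    InClass c u v = Edge (Path (2 + n)) u v × block u v ≡ c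
    cross : ∀ c u v u' v' → InClass c u v → InClass c u' v' → index u v ≤ index u' v' →
      InClass c u v' ⊎ InClass c u' v
    cross c u v u' v' (uv , uv∈c) (u'v' , u'v'∈c) uv≤u'v' =
      Sum.map (inClass {u} {v'}) (inClass {u'} {v})
        (sameBlock⇒crossingEdge (pathAdjℕ⇒PathEdge (toℕ u) (toℕ v) uv)
          (pathAdjℕ⇒PathEdge (toℕ u') (toℕ v') u'v') uv≤u'v'
          (block-injective {u} {v} {u'} {v'} (trans uv∈c (sym u'v'∈c))))
      where
      inClass : ∀ {x y} →
        PathEdge (toℕ x) (toℕ y) × index x y / 3 ≡ index u v / 3 → InClass c x y
      inClass {x} {y} (xy , sameBlock) =
        PathEdge⇒pathAdjℕ xy , trans (block-cong {x} {y} {u} {v} sameBlock) uv∈c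

  matchingIndex≤ : (t : Fin (suc (n / 3))) → toℕ t * 3 ≤ n
  matchingIndex≤ t = ≤-trans (*-monoˡ-≤ 3 (toℕ≤pred[n] t)) (m/n*n≤m n 3)

  pathInducedMatching : InducedMatching (Path (2 + n)) (suc (n / 3))
  pathInducedMatching = a , b , matched , induced
    where
    a : Fin (suc (n / 3)) → U
    a t = fromℕ< (s≤s (⌈n/2⌉-mono (matchingIndex≤ t)))
    b : Fin (suc (n / 3)) → V
    b t = fromℕ< (s≤s (⌊n/2⌋-mono (matchingIndex≤ t)))
    ends-ab : ∀ s t →
      PathEdge (toℕ (a s)) (toℕ (b t)) → PathEdge ⌈ toℕ s * 3 /2⌉ ⌊ toℕ t * 3 /2⌋
    ends-ab s t = subst₂ PathEdge (toℕ-fromℕ< _) (toℕ-fromℕ< _)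
    matched : ∀ t → Edge (Path (2 + n)) (a t) (b t)
    matched t = PathEdge⇒pathAdjℕ
      (subst₂ PathEdge (sym (toℕ-fromℕ< _)) (sym (toℕ-fromℕ< _)) (PathEdge-ends (toℕ t * 3)))
    induced : ∀ s t → s ≢ t → ¬ Edge (Path (2 + n)) (a s) (b t)
    induced s t s≢t edge =
      far⇒¬PathEdge spread (ends-ab s t (pathAdjℕ⇒PathEdge _ _ edge))
      where
      spread : 3 + toℕ s * 3 ≤ toℕ t * 3 ⊎ 3 + toℕ t * 3 ≤ toℕ s * 3
      spread with <-cmp (toℕ s) (toℕ t)
      ... | tri< s<t _ _ = inj₁ (*-monoˡ-≤ 3 s<t)
      ... | tri≈ _ s≡t _ = ⊥-elim (s≢t (toℕ-injective s≡t))
      ... | tri> _ _ t<s = inj₂ (*-monoˡ-≤ 3 t<s)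

ceilNm1div3-2+ : ∀ n → ceilNm1div3 (2 + n) ≡ suc (n / 3)
ceilNm1div3-2+ n = trans (cong (_/ 3) (+-comm (suc n) 2)) ([3+n]/3≡1+n/3 n)

theorem5p2 : (n : ℕ) → 2 ≤ n →
    FpEq (Path n) (ceilNm1div3 n) × NuIndEq (Path n) (ceilNm1div3 n)
theorem5p2 (suc (suc n)) _ rewrite ceilNm1div3-2+ n =
  fpEq×nuIndEq (pathInducedMatching n) (pathFerrersPartition n)
theorem5p2 1 (s≤s ())
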